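{- Let $k,l\ge1$ with $k\ne l$, and $1\le r\le(2k+1)(2l+1)$. Let $\overline{\mathcal{B}}(2k+1,2l+1;r)$ be the set of boards in $\mathcal{B}(2k+1,2l+1;r)$ whose board partition $\begin{pmatrix}\lambda_1&\lambda_2&\lambda_3&\lambda_4\\ \delta_1&\delta_2&\delta_3&\delta_4\end{pmatrix}_c$ satisfies: (i) $\lambda_1\ge\lambda_i$ for all $i>1$; (ii) if $\lambda_1=\lambda_3$ then $\lambda_2\ge\lambda_4$; if in addition $\lambda_2=\lambda_4$ then $\delta_1\ge\delta_3$; if further $\delta_1=\delta_3$ then $\delta_2\ge\delta_4$; (iii) if $\lambda_1=\lambda_2$ then $\lambda_3\ge\lambda_4$; if in addition $\lambda_3=\lambda_4$ then $\delta_2\ge\delta_4$; (iv) if $\lambda_1=\lambda_4$ then $\lambda_2\ge\lambda_3$; if in addition $\lambda_2=\lambda_3$ then $\delta_1\ge\delta_3$. Then: (1) $\overline{\mathcal{B}}(2k+1,2l+1;r)$ is the disjoint union of the sets of all boards of $\mathcal{B}(2k+1,2l+1;r)$ having a given board partition, over finitely many board partitions; (2) every board in $\mathcal{B}(2k+1,2l+1;r)$ is equivalent under $G=\{R_0,H,V,R_{180}\}$ to some board in $\overline{\mathcal{B}}(2k+1,2l+1;r)$; (3) any two boards in $\overline{\mathcal{B}}(2k+1,2l+1;r)$ equivalent under $G$ have the same board partition.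
   Context: A $(2k+1)\times(2l+1)$ grid has cells $(i,j)$, $1\le i\le 2k+1$ (row from top), $1\le j\le 2l+1$ (column from left). $\mathcal{B}(2k+1,2l+1;r)$ is the set of all choices of exactly $r$ blocked cells. $G=\{R_0,H,V,R_{180}\}$ acts by identity, reflection across the horizontal midline ($(i,j)\mapsto(2k+2-i,j)$), reflection across the vertical midline ($(i,j)\mapsto(i,2l+2-j)$), and rotation by 180 degrees. Boards are equivalent if one is an image of the other. Regions: upper-left corner (rows $1..k$, columns $1..l$), top strip (rows $1..k$, column $l+1$), upper-right corner (rows $1..k$, columns $l+2..2l+1$), right strip (row $k+1$, columns $l+2..2l+1$), lower-right corner (rows $k+2..2k+1$, columns $l+2..2l+1$), bottom strip (rows $k+2..2k+1$, column $l+1$), lower-left corner (rows $k+2..2k+1$, columns $1..l$), left strip (row $k+1$, columns $1..l$), center $(k+1,l+1)$. The board partition $\begin{pmatrix}\lambda_1&\lambda_2&\lambda_3&\lambda_4\\ \delta_1&\delta_2&\delta_3&\delta_4\end{pmatrix}_c$ gives the numbers of blocked cells: $\lambda_1,\dots,\lambda_4$ in the upper-left, upper-right, lower-right, lower-left corners; $\delta_1,\dots,\delta_4$ in the top, right, bottom, left strips; $c\in\{0,1\}$ in the center. -}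

module Defs where

open import Data.Nat using (ℕ; zero; suc; _+_; _*_; _≤_; _<ᵇ_; _≡ᵇ_)
open import Data.Fin using (Fin; toℕ; opposite; zero; suc)
open import Data.Bool using (Bool; true; false; if_then_else_; _∧_)
open import Data.Product using (_×_; Σ)
open import Relation.Binary.PropositionalEquality using (_≡_)

dim : ℕ → ℕ
dim k = 2 * k + 1

-- A board on an m × n grid: cell (i , j) (0-indexed row i from the top,
-- column j from the left) is blocked iff the value is true.
Board : ℕ → ℕ → Set
Board m n = Fin m → Fin n → Bool

sumFin : (n : ℕ) → (Fin n → ℕ) → ℕ
sumFin zero    f = 0
sumFin (suc n) f = f zero + sumFin n (λ i → f (suc i))

count : Bool → ℕ
count true  = 1
count false = 0

countWhere : {m n : ℕ} → (Fin m → Fin n → Bool) → Board m n → ℕ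
countWhere {m} {n} P b = sumFin m (λ i → sumFin n (λ j → count (P i j ∧ b i j)))

blocked : {m n : ℕ} → Board m n → ℕ
blocked b = countWhere (λ _ _ → true) b

data Zone : Set where
  lo mid hi : Zone

zone : (k : ℕ) → {m : ℕ} → Fin m → Zone
zone k x = if toℕ x <ᵇ k then lo else (if toℕ x ≡ᵇ k then mid else hi)

_==Z_ : Zone → Zone → Bool
lo  ==Z lo  = true
mid ==Z mid = true
hi  ==Z hi  = true
_   ==Z _   = false

inRegion : (k l : ℕ) → Zone → Zone → Fin (dim k) → Fin (dim l) → Bool
inRegion k l zr zc i j = (zone k i ==Z zr) ∧ (zone l j ==Z zc)

regionCount : (k l : ℕ) → Zone → Zone → Board (dim k) (dim l) → ℕ
regionCount k l zr zc b = countWhere (inRegion k l zr zc) b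

record Partition : Set where
  constructor mkPartition
  field
    λ₁ λ₂ λ₃ λ₄ δ₁ δ₂ δ₃ δ₄ c : ℕ

boardPartition : (k l : ℕ) → Board (dim k) (dim l) → Partition
boardPartition k l b = mkPartition
  (regionCount k l lo  lo  b)
  (regionCount k l lo  hi  b)
  (regionCount k l hi  hi  b)
  (regionCount k l hi  lo  b)
  (regionCount k l lo  mid b)
  (regionCount k l mid hi  b)
  (regionCount k l hi  mid b)
  (regionCount k l mid lo  b)
  (regionCount k l mid mid b)

Canonical : Partition → Set
Canonical p =
    (λ₂ ≤ λ₁ × λ₃ ≤ λ₁ × λ₄ ≤ λ₁)
  × (λ₁ ≡ λ₃ → λ₄ ≤ λ₂ × (λ₂ ≡ λ₄ → δ₃ ≤ δ₁ × (δ₁ ≡ δ₃ → δ₄ ≤ δ₂)))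
  × (λ₁ ≡ λ₂ → λ₄ ≤ λ₃ × (λ₃ ≡ λ₄ → δ₄ ≤ δ₂))
  × (λ₁ ≡ λ₄ → λ₃ ≤ λ₂ × (λ₂ ≡ λ₃ → δ₃ ≤ δ₁))
  where open Partition p

InB : (k l r : ℕ) → Board (dim k) (dim l) → Set
InB k l r b = blocked b ≡ r

InBbar : (k l r : ℕ) → Board (dim k) (dim l) → Set
InBbar k l r b = InB k l r b × Canonical (boardPartition k l b)

data G : Set where
  R0 H V R180 : G

-- Action on boards. `opposite` sends 0-based index i to (m-1)-i, i.e. the
-- 1-based map i ↦ 2k+2-i. All elements are involutions, so the image board
-- g·b has cell x blocked iff g(x) is blocked in b.
act : {m n : ℕ} → G → Board m n → Board m n
act R0   b i j = b i j
act H    b i j = b (opposite i) j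
act V    b i j = b i (opposite j)
act R180 b i j = b (opposite i) (opposite j)

_≈B_ : {m n : ℕ} → Board m n → Board m n → Set
b ≈B b' = ∀ i j → b i j ≡ b' i j

Equivalent : {m n : ℕ} → Board m n → Board m n → Set
Equivalent b b' = Σ G (λ g → b' ≈B act g b)

{-# OPTIONS --safe #-}
-- G acts on board partitions by permuting the four corner counts and the four
-- strip counts, compatibly with its action on boards. Conditions (i)-(iv) on a partition p say
-- that the key (λ₁, λ₂, λ₃, δ₁, δ₂) of p is lexicographically maximal in the G-orbit of p, so
-- moving a board by a maximiser of its orbit gives (2). If both p and g·p satisfy (i)-(iv),
-- the inequalities pair up into equalities forcing g·p = p, which gives (3). For (1), every
-- region count is at most r, so the canonical partitions with entries ≤ r form a finite list.
module Submission where

open import Defs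
open import Data.Nat using (ℕ; _≤_; _*_)
open import Data.Product using (Σ; _×_; ∃)
open import Data.List using (List)
open import Data.List.Membership.Propositional using (_∈_)
open import Data.List.Relation.Unary.Unique.Propositional using (Unique)
open import Function.Bundles using (_⇔_)
open import Relation.Nullary using (¬_)
open import Relation.Binary.PropositionalEquality using (_≡_)

open import Data.Nat using (zero; suc; _+_; _∸_; _<_; _<ᵇ_; _≡ᵇ_; z≤n; s≤s; s≤s⁻¹; _≤?_; _≟_)
open import Data.Nat.Properties
  using ( +-comm; +-identityʳ; +-mono-≤; m≤m+n; m+n∸n≡m; ∸-monoʳ-<; ≤-refl; ≤-antisym; <⇒≤; n≮n
        ; <⇒≯; >⇒≢; <-cmp; <⇒<ᵇ; <ᵇ⇒<; ≡⇒≡ᵇ; ≡ᵇ⇒≡; <-strictTotalOrder; +-0-commutativeMonoid )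
open import Data.Fin using (Fin; toℕ; opposite) renaming (zero to fzero; suc to fsuc)
open import Data.Fin.Properties using (opposite-prop; opposite-involutive; toℕ<n)
open import Data.Fin.Permutation using (reverse)
open import Data.Bool using (Bool; true; false; _∧_; if_then_else_)
open import Data.Product using (_,_; proj₁; proj₂)
open import Data.Vec using (Vec; []; _∷_)
open import Data.Vec.Properties using (∷-injective)
open import Data.Vec.Relation.Unary.All using (All; []; _∷_)
open import Data.List using ([]; _∷_; map; filter; upTo; cartesianProductWith)
open import Data.List.Relation.Unary.Any using (here; there)
open import Data.List.Relation.Unary.All using ([]; lookup)
open import Data.List.Relation.Unary.AllPairs using ([]; _∷_)
open import Data.List.Membership.Propositional.Properties
  using (∈-upTo⁺; ∈-cartesianProductWith⁺; ∈-map⁺; ∈-filter⁺; ∈-filter⁻)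
import Data.List.Relation.Unary.Unique.Propositional.Properties as Unique
open import Data.List.Relation.Binary.Lex.Core using (this; next)
import Data.List.Relation.Binary.Lex.Strict as Lex
open import Algebra.Properties.CommutativeMonoid.Sum +-0-commutativeMonoid using (sum; sum-permute)
open import Function.Bundles using (Equivalence; mk⇔)
open import Function.Nary.NonDependent using (congₙ)
open import Relation.Binary.Bundles using (TotalOrder; DecTotalOrder)
open import Relation.Binary.Definitions using (tri<; tri≈; tri>)
open import Relation.Binary.PropositionalEquality
  using (refl; sym; trans; cong; cong₂; subst; module ≡-Reasoning)
open import Relation.Nullary using (contradiction)
open import Relation.Nullary.Decidable using (_×-dec_; _→-dec_)
open import Relation.Unary using (Decidable)

sumFin≡sum : ∀ n (f : Fin n → ℕ) → sumFin n f ≡ sum f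
sumFin≡sum zero    f = refl
sumFin≡sum (suc n) f = cong (f fzero +_) (sumFin≡sum n (λ i → f (fsuc i)))

sumFin-cong : ∀ n {f g : Fin n → ℕ} → (∀ i → f i ≡ g i) → sumFin n f ≡ sumFin n g
sumFin-cong zero    f≗g = refl
sumFin-cong (suc n) f≗g = cong₂ _+_ (f≗g fzero) (sumFin-cong n (λ i → f≗g (fsuc i)))

sumFin-mono-≤ : ∀ n {f g : Fin n → ℕ} → (∀ i → f i ≤ g i) → sumFin n f ≤ sumFin n g
sumFin-mono-≤ zero    f≤g = z≤n
sumFin-mono-≤ (suc n) f≤g = +-mono-≤ (f≤g fzero) (sumFin-mono-≤ n (λ i → f≤g (fsuc i)))

sumFin-opposite : ∀ n (f : Fin n → ℕ) → sumFin n f ≡ sumFin n (λ i → f (opposite i))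
sumFin-opposite n f = begin
  sumFin n f                      ≡⟨ sumFin≡sum n f ⟩
  sum f                           ≡⟨ sum-permute f reverse ⟩
  sum (λ i → f (opposite i))      ≡⟨ sumFin≡sum n _ ⟨
  sumFin n (λ i → f (opposite i)) ∎
  where open ≡-Reasoning

countWhere-cong : ∀ {m n} {P Q : Fin m → Fin n → Bool} {b b′ : Board m n} →
  (∀ i j → P i j ≡ Q i j) → b ≈B b′ → countWhere P b ≡ countWhere Q b′
countWhere-cong {m} {n} P≗Q b≈b′ =
  sumFin-cong m (λ i → sumFin-cong n (λ j → cong₂ (λ p x → count (p ∧ x)) (P≗Q i j) (b≈b′ i j)))

countWhere≤blocked : ∀ {m n} (P : Fin m → Fin n → Bool) (b : Board m n) → countWhere P b ≤ blocked b
countWhere≤blocked {m} {n} P b = sumFin-mono-≤ m (λ i → sumFin-mono-≤ n (λ j → count-∧≤ (P i j) (b i j)))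
  where
  count-∧≤ : ∀ p x → count (p ∧ x) ≤ count x
  count-∧≤ true  x     = ≤-refl
  count-∧≤ false true  = z≤n
  count-∧≤ false false = z≤n

countWhere-act-H : ∀ {m n} (P : Fin m → Fin n → Bool) (b : Board m n) →
  countWhere P (act H b) ≡ countWhere (λ i j → P (opposite i) j) b
countWhere-act-H {m} {n} P b = begin
  sumFin m (λ i → sumFin n (λ j → count (P i j ∧ b (opposite i) j)))
    ≡⟨ sumFin-opposite m _ ⟩
  sumFin m (λ i → sumFin n (λ j → count (P (opposite i) j ∧ b (opposite (opposite i)) j)))
    ≡⟨ countWhere-cong (λ _ _ → refl) (λ i j → cong (λ i′ → b i′ j) (opposite-involutive i)) ⟩
  sumFin m (λ i → sumFin n (λ j → count (P (opposite i) j ∧ b i j))) ∎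
  where open ≡-Reasoning

countWhere-act-V : ∀ {m n} (P : Fin m → Fin n → Bool) (b : Board m n) →
  countWhere P (act V b) ≡ countWhere (λ i j → P i (opposite j)) b
countWhere-act-V {m} {n} P b = begin
  sumFin m (λ i → sumFin n (λ j → count (P i j ∧ b i (opposite j))))
    ≡⟨ sumFin-cong m (λ i → sumFin-opposite n _) ⟩
  sumFin m (λ i → sumFin n (λ j → count (P i (opposite j) ∧ b i (opposite (opposite j)))))
    ≡⟨ countWhere-cong (λ _ _ → refl) (λ i j → cong (b i) (opposite-involutive j)) ⟩
  sumFin m (λ i → sumFin n (λ j → count (P i (opposite j) ∧ b i j))) ∎
  where open ≡-Reasoning

blocked-act : ∀ {m n} g (b : Board m n) → blocked (act g b) ≡ blocked b
blocked-act R0   b = refl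
blocked-act H    b = countWhere-act-H _ b
blocked-act V    b = countWhere-act-V _ b
blocked-act R180 b = trans (countWhere-act-H _ (act V b)) (countWhere-act-V _ b)

flipZ : Zone → Zone
flipZ lo  = hi
flipZ mid = mid
flipZ hi  = lo

flipZ-==Z : ∀ z w → (flipZ z ==Z w) ≡ (z ==Z flipZ w)
flipZ-==Z lo  lo  = refl
flipZ-==Z lo  mid = refl
flipZ-==Z lo  hi  = refl
flipZ-==Z mid lo  = refl
flipZ-==Z mid mid = refl
flipZ-==Z mid hi  = refl
flipZ-==Z hi  lo  = refl
flipZ-==Z hi  mid = refl
flipZ-==Z hi  hi  = refl

zoneℕ : ℕ → ℕ → Zone
zoneℕ k n = if n <ᵇ k then lo else (if n ≡ᵇ k then mid else hi)

zoneℕ-lo : ∀ {k n} → n < k → zoneℕ k n ≡ lo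
zoneℕ-lo {k} {n} n<k with n <ᵇ k | <⇒<ᵇ n<k
... | true | _ = refl

zoneℕ-mid : ∀ k → zoneℕ k k ≡ mid
zoneℕ-mid k with k <ᵇ k | <ᵇ⇒< k k | k ≡ᵇ k | ≡⇒≡ᵇ k k refl
... | false | _ | true | _ = refl
... | true | k<k | _ | _ = contradiction (k<k _) (n≮n k)

zoneℕ-hi : ∀ {k n} → k < n → zoneℕ k n ≡ hi
zoneℕ-hi {k} {n} k<n with n <ᵇ k | <ᵇ⇒< n k | n ≡ᵇ k | ≡ᵇ⇒≡ n k
... | false | _ | false | _ = refl
... | true | n<k | _ | _ = contradiction (n<k _) (<⇒≯ k<n)
... | false | _ | true | n≡k = contradiction (n≡k _) (>⇒≢ k<n)

zoneℕ-mirror : ∀ k n → n ≤ k + k → zoneℕ k (k + k ∸ n) ≡ flipZ (zoneℕ k n)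
zoneℕ-mirror k n n≤2k with <-cmp n k
... | tri< n<k _ _ rewrite zoneℕ-lo n<k =
  zoneℕ-hi (subst (_< k + k ∸ n) (m+n∸n≡m k k) (∸-monoʳ-< n<k (m≤m+n k k)))
... | tri≈ _ refl _ rewrite m+n∸n≡m k k | zoneℕ-mid k = refl
... | tri> _ _ k<n rewrite zoneℕ-hi k<n =
  zoneℕ-lo (subst (k + k ∸ n <_) (m+n∸n≡m k k) (∸-monoʳ-< k<n n≤2k))

dim≡suc[k+k] : ∀ k → dim k ≡ suc (k + k)
dim≡suc[k+k] k = trans (+-comm (2 * k) 1) (cong (λ x → suc (k + x)) (+-identityʳ k))

zone-opposite : ∀ k (i : Fin (dim k)) → zone k (opposite i) ≡ flipZ (zone k i)
zone-opposite k i = begin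
  zoneℕ k (toℕ (opposite i))        ≡⟨ cong (zoneℕ k) (opposite-prop i) ⟩
  zoneℕ k (dim k ∸ suc (toℕ i))     ≡⟨ cong (λ d → zoneℕ k (d ∸ suc (toℕ i))) (dim≡suc[k+k] k) ⟩
  zoneℕ k (k + k ∸ toℕ i)           ≡⟨ zoneℕ-mirror k (toℕ i) i≤2k ⟩
  flipZ (zoneℕ k (toℕ i))           ∎
  where
  open ≡-Reasoning
  i≤2k : toℕ i ≤ k + k
  i≤2k = s≤s⁻¹ (subst (toℕ i <_) (dim≡suc[k+k] k) (toℕ<n i))

regionCount-act-H : ∀ k l zr zc (b : Board (dim k) (dim l)) →
  regionCount k l zr zc (act H b) ≡ regionCount k l (flipZ zr) zc b
regionCount-act-H k l zr zc b = trans (countWhere-act-H _ b) (countWhere-cong inRegion-opposite λ _ _ → refl)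
  where
  inRegion-opposite : ∀ i j → inRegion k l zr zc (opposite i) j ≡ inRegion k l (flipZ zr) zc i j
  inRegion-opposite i j =
    cong (_∧ (zone l j ==Z zc)) (trans (cong (_==Z zr) (zone-opposite k i)) (flipZ-==Z (zone k i) zr))

regionCount-act-V : ∀ k l zr zc (b : Board (dim k) (dim l)) →
  regionCount k l zr zc (act V b) ≡ regionCount k l zr (flipZ zc) b
regionCount-act-V k l zr zc b = trans (countWhere-act-V _ b) (countWhere-cong inRegion-opposite λ _ _ → refl)
  where
  inRegion-opposite : ∀ i j → inRegion k l zr zc i (opposite j) ≡ inRegion k l zr (flipZ zc) i j
  inRegion-opposite i j =
    cong ((zone k i ==Z zr) ∧_) (trans (cong (_==Z zc) (zone-opposite l j)) (flipZ-==Z (zone l j) zc))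

-- boardPartition k l b is definitionally partitionOf (λ zr zc → regionCount k l zr zc b).
partitionOf : (Zone → Zone → ℕ) → Partition
partitionOf f =
  mkPartition (f lo lo) (f lo hi) (f hi hi) (f hi lo) (f lo mid) (f mid hi) (f hi mid) (f mid lo) (f mid mid)

partitionOf-cong : ∀ {f f′ : Zone → Zone → ℕ} → (∀ zr zc → f zr zc ≡ f′ zr zc) →
  partitionOf f ≡ partitionOf f′
partitionOf-cong f≗f′ = congₙ 9 mkPartition
  (f≗f′ lo lo) (f≗f′ lo hi) (f≗f′ hi hi) (f≗f′ hi lo)
  (f≗f′ lo mid) (f≗f′ mid hi) (f≗f′ hi mid) (f≗f′ mid lo) (f≗f′ mid mid)

actP : G → Partition → Partition
actP R0   p = p
actP H    (mkPartition λ₁ λ₂ λ₃ λ₄ δ₁ δ₂ δ₃ δ₄ c) = mkPartition λ₄ λ₃ λ₂ λ₁ δ₃ δ₂ δ₁ δ₄ c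
actP V    (mkPartition λ₁ λ₂ λ₃ λ₄ δ₁ δ₂ δ₃ δ₄ c) = mkPartition λ₂ λ₁ λ₄ λ₃ δ₁ δ₄ δ₃ δ₂ c
actP R180 (mkPartition λ₁ λ₂ λ₃ λ₄ δ₁ δ₂ δ₃ δ₄ c) = mkPartition λ₃ λ₄ λ₁ λ₂ δ₃ δ₄ δ₁ δ₂ c

boardPartition-act : ∀ k l g (b : Board (dim k) (dim l)) →
  boardPartition k l (act g b) ≡ actP g (boardPartition k l b)
boardPartition-act k l R0   b = refl
boardPartition-act k l H    b = partitionOf-cong (λ zr zc → regionCount-act-H k l zr zc b)
boardPartition-act k l V    b = partitionOf-cong (λ zr zc → regionCount-act-V k l zr zc b)
boardPartition-act k l R180 b = partitionOf-cong λ zr zc →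
  trans (regionCount-act-H k l zr zc (act V b)) (regionCount-act-V k l (flipZ zr) zc b)

boardPartition-cong : ∀ k l {b b′ : Board (dim k) (dim l)} → b ≈B b′ →
  boardPartition k l b ≡ boardPartition k l b′
boardPartition-cong k l b≈b′ =
  partitionOf-cong (λ zr zc → countWhere-cong {P = inRegion k l zr zc} (λ _ _ → refl) b≈b′)

_·_ : G → G → G
R0   · g    = g
g    · R0   = g
H    · H    = R0
H    · V    = R180
H    · R180 = V
V    · H    = R180
V    · V    = R0
V    · R180 = H
R180 · H    = V
R180 · V    = H
R180 · R180 = R0

actP-· : ∀ h g p → actP h (actP g p) ≡ actP (h · g) p
actP-· R0   g    p = refl
actP-· H    R0   p = refl
actP-· H    H    p = refl
actP-· H    V    p = refl
actP-· H    R180 p = refl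
actP-· V    R0   p = refl
actP-· V    H    p = refl
actP-· V    V    p = refl
actP-· V    R180 p = refl
actP-· R180 R0   p = refl
actP-· R180 H    p = refl
actP-· R180 V    p = refl
actP-· R180 R180 p = refl

allG : List G
allG = R0 ∷ H ∷ V ∷ R180 ∷ []

∈-allG : ∀ g → g ∈ allG
∈-allG R0   = here refl
∈-allG H    = there (here refl)
∈-allG V    = there (there (here refl))
∈-allG R180 = there (there (there (here refl)))

canonical-fixed : ∀ g p → Canonical p → Canonical (actP g p) → actP g p ≡ p
canonical-fixed R0 p _ _ = refl
canonical-fixed H (mkPartition λ₁ λ₂ λ₃ λ₄ δ₁ δ₂ δ₃ δ₄ c)
                  ((_ , _ , λ₄≤λ₁) , _ , _ , iv) ((_ , _ , λ₁≤λ₄) , _ , _ , iv′)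
  with ≤-antisym λ₁≤λ₄ λ₄≤λ₁
... | refl with ≤-antisym (proj₁ (iv′ refl)) (proj₁ (iv refl))
... | refl with ≤-antisym (proj₂ (iv′ refl) refl) (proj₂ (iv refl) refl)
... | refl = refl
canonical-fixed V (mkPartition λ₁ λ₂ λ₃ λ₄ δ₁ δ₂ δ₃ δ₄ c)
                  ((λ₂≤λ₁ , _ , _) , _ , iii , _) ((λ₁≤λ₂ , _ , _) , _ , iii′ , _)
  with ≤-antisym λ₁≤λ₂ λ₂≤λ₁
... | refl with ≤-antisym (proj₁ (iii′ refl)) (proj₁ (iii refl))
... | refl with ≤-antisym (proj₂ (iii′ refl) refl) (proj₂ (iii refl) refl)
... | refl = refl
canonical-fixed R180 (mkPartition λ₁ λ₂ λ₃ λ₄ δ₁ δ₂ δ₃ δ₄ c)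
                     ((_ , λ₃≤λ₁ , _) , ii , _) ((_ , λ₁≤λ₃ , _) , ii′ , _)
  with ≤-antisym λ₁≤λ₃ λ₃≤λ₁
... | refl with ≤-antisym (proj₁ (ii′ refl)) (proj₁ (ii refl))
... | refl with ≤-antisym (proj₁ (proj₂ (ii′ refl) refl)) (proj₁ (proj₂ (ii refl) refl))
... | refl with ≤-antisym (proj₂ (proj₂ (ii′ refl) refl) refl) (proj₂ (proj₂ (ii refl) refl) refl)
... | refl = refl

module _ {c ℓ₁ ℓ₂} (O : TotalOrder c ℓ₁ ℓ₂) where
  open TotalOrder O using (Carrier) renaming (_≤_ to _⊑_)
  open import Data.List.Extrema O using (argmax; f[xs]≤f[argmax])

  -- Opaque: unfolding argmax on symbolic keys during conversion checking exhausts memory.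
  opaque
    maximiser : (f : G → Carrier) → Σ G (λ g → ∀ h → f h ⊑ f g)
    maximiser f = argmax f R0 allG , λ h → lookup (f[xs]≤f[argmax] {f = f} R0 allG) (∈-allG h)

lexTotalOrder : TotalOrder _ _ _
lexTotalOrder = DecTotalOrder.totalOrder (Lex.≤-decTotalOrder <-strictTotalOrder)

open TotalOrder lexTotalOrder using () renaming (_≤_ to _≤ₗ_)

key : Partition → List ℕ
key p = λ₁ ∷ λ₂ ∷ λ₃ ∷ δ₁ ∷ δ₂ ∷ []
  where open Partition p

strictly : ∀ {A : Set} {x y} → x < y → x ≤ y × (y ≡ x → A)
strictly x<y = <⇒≤ x<y , λ y≡x → contradiction y≡x (>⇒≢ x<y)

tie : ∀ {A : Set} {x} → A → x ≤ x × (x ≡ x → A)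
tie a = ≤-refl , λ _ → a

private variable
  λ₁ λ₂ λ₃ λ₄ δ₁ δ₂ δ₃ δ₄ : ℕ

≤ₗ-H⇒ : (λ₄ ∷ λ₃ ∷ λ₂ ∷ δ₃ ∷ δ₂ ∷ []) ≤ₗ (λ₁ ∷ λ₂ ∷ λ₃ ∷ δ₁ ∷ δ₂ ∷ []) →
  λ₄ ≤ λ₁ × (λ₁ ≡ λ₄ → λ₃ ≤ λ₂ × (λ₂ ≡ λ₃ → δ₃ ≤ δ₁))
≤ₗ-H⇒ (this lt)                                      = strictly lt
≤ₗ-H⇒ (next refl (this lt))                          = tie (strictly lt)
≤ₗ-H⇒ (next refl (next refl (this lt)))              = contradiction lt (n≮n _)
≤ₗ-H⇒ (next refl (next refl (next _ (this lt))))     = tie (tie (<⇒≤ lt))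
≤ₗ-H⇒ (next refl (next refl (next _ (next refl _)))) = tie (tie ≤-refl)

≤ₗ-V⇒ : (λ₂ ∷ λ₁ ∷ λ₄ ∷ δ₁ ∷ δ₄ ∷ []) ≤ₗ (λ₁ ∷ λ₂ ∷ λ₃ ∷ δ₁ ∷ δ₂ ∷ []) →
  λ₂ ≤ λ₁ × (λ₁ ≡ λ₂ → λ₄ ≤ λ₃ × (λ₃ ≡ λ₄ → δ₄ ≤ δ₂))
≤ₗ-V⇒ (this lt)                                                 = strictly lt
≤ₗ-V⇒ (next refl (this lt))                                     = contradiction lt (n≮n _)
≤ₗ-V⇒ (next refl (next _ (this lt)))                            = tie (strictly lt)
≤ₗ-V⇒ (next refl (next _ (next refl (this lt))))                = contradiction lt (n≮n _)
≤ₗ-V⇒ (next refl (next _ (next refl (next _ (this lt)))))       = tie (tie (<⇒≤ lt))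
≤ₗ-V⇒ (next refl (next _ (next refl (next _ (next refl _)))))   = tie (tie ≤-refl)

≤ₗ-R180⇒ : (λ₃ ∷ λ₄ ∷ λ₁ ∷ δ₃ ∷ δ₄ ∷ []) ≤ₗ (λ₁ ∷ λ₂ ∷ λ₃ ∷ δ₁ ∷ δ₂ ∷ []) →
  λ₃ ≤ λ₁ × (λ₁ ≡ λ₃ → λ₄ ≤ λ₂ × (λ₂ ≡ λ₄ → δ₃ ≤ δ₁ × (δ₁ ≡ δ₃ → δ₄ ≤ δ₂)))
≤ₗ-R180⇒ (this lt)                                                   = strictly lt
≤ₗ-R180⇒ (next refl (this lt))                                       = tie (strictly lt)
≤ₗ-R180⇒ (next refl (next refl (this lt)))                           = contradiction lt (n≮n _)
≤ₗ-R180⇒ (next refl (next refl (next _ (this lt))))                  = tie (tie (strictly lt))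
≤ₗ-R180⇒ (next refl (next refl (next _ (next refl (this lt)))))      = tie (tie (tie (<⇒≤ lt)))
≤ₗ-R180⇒ (next refl (next refl (next _ (next refl (next refl _)))))  = tie (tie (tie ≤-refl))

maximal⇒canonical : ∀ q → (∀ h → key (actP h q) ≤ₗ key q) → Canonical q
maximal⇒canonical q maximal
  with ≤ₗ-H⇒ (maximal H) | ≤ₗ-V⇒ (maximal V) | ≤ₗ-R180⇒ (maximal R180)
... | λ₄≤λ₁ , iv | λ₂≤λ₁ , iii | λ₃≤λ₁ , ii = (λ₂≤λ₁ , λ₃≤λ₁ , λ₄≤λ₁) , ii , iii , iv

orbit-maximal⇒canonical : ∀ p g → (∀ h → key (actP h p) ≤ₗ key (actP g p)) → Canonical (actP g p)
orbit-maximal⇒canonical p g maximal = maximal⇒canonical (actP g p) λ h →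
  subst (λ q → key q ≤ₗ key (actP g p)) (sym (actP-· h g p)) (maximal (h · g))

canonical-in-orbit : ∀ p → Σ G (λ g → Canonical (actP g p))
canonical-in-orbit p with maximiser lexTotalOrder (λ g → key (actP g p))
... | g , maximal = g , orbit-maximal⇒canonical p g maximal

boundedVecs : ℕ → (n : ℕ) → List (Vec ℕ n)
boundedVecs r zero    = [] ∷ []
boundedVecs r (suc n) = cartesianProductWith _∷_ (upTo (suc r)) (boundedVecs r n)

boundedVecs-unique : ∀ r n → Unique (boundedVecs r n)
boundedVecs-unique r zero    = [] ∷ []
boundedVecs-unique r (suc n) =
  Unique.cartesianProductWith⁺ _∷_ ∷-injective (Unique.upTo⁺ (suc r)) (boundedVecs-unique r n)

∈-boundedVecs : ∀ {r n} {v : Vec ℕ n} → All (_≤ r) v → v ∈ boundedVecs r n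
∈-boundedVecs []           = here refl
∈-boundedVecs (x≤r ∷ xs≤r) = ∈-cartesianProductWith⁺ _∷_ (∈-upTo⁺ (s≤s x≤r)) (∈-boundedVecs xs≤r)

entries : Partition → Vec ℕ 9
entries (mkPartition λ₁ λ₂ λ₃ λ₄ δ₁ δ₂ δ₃ δ₄ c) = λ₁ ∷ λ₂ ∷ λ₃ ∷ λ₄ ∷ δ₁ ∷ δ₂ ∷ δ₃ ∷ δ₄ ∷ c ∷ []

fromEntries : Vec ℕ 9 → Partition
fromEntries (λ₁ ∷ λ₂ ∷ λ₃ ∷ λ₄ ∷ δ₁ ∷ δ₂ ∷ δ₃ ∷ δ₄ ∷ c ∷ []) = mkPartition λ₁ λ₂ λ₃ λ₄ δ₁ δ₂ δ₃ δ₄ c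

fromEntries-injective : ∀ {v w} → fromEntries v ≡ fromEntries w → v ≡ w
fromEntries-injective {_ ∷ _ ∷ _ ∷ _ ∷ _ ∷ _ ∷ _ ∷ _ ∷ _ ∷ []} {_ ∷ _ ∷ _ ∷ _ ∷ _ ∷ _ ∷ _ ∷ _ ∷ _ ∷ []} refl = refl

canonical? : Decidable Canonical
canonical? (mkPartition λ₁ λ₂ λ₃ λ₄ δ₁ δ₂ δ₃ δ₄ c) =
  ((λ₂ ≤? λ₁) ×-dec (λ₃ ≤? λ₁) ×-dec (λ₄ ≤? λ₁))
  ×-dec ((λ₁ ≟ λ₃) →-dec ((λ₄ ≤? λ₂) ×-dec ((λ₂ ≟ λ₄) →-dec ((δ₃ ≤? δ₁) ×-dec ((δ₁ ≟ δ₃) →-dec (δ₄ ≤? δ₂))))))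
  ×-dec ((λ₁ ≟ λ₂) →-dec ((λ₄ ≤? λ₃) ×-dec ((λ₃ ≟ λ₄) →-dec (δ₄ ≤? δ₂))))
  ×-dec ((λ₁ ≟ λ₄) →-dec ((λ₃ ≤? λ₂) ×-dec ((λ₂ ≟ λ₃) →-dec (δ₃ ≤? δ₁))))

canonicalPartitions : ℕ → List Partition
canonicalPartitions r = filter canonical? (map fromEntries (boundedVecs r 9))

canonicalPartitions-unique : ∀ r → Unique (canonicalPartitions r)
canonicalPartitions-unique r =
  Unique.filter⁺ canonical? (Unique.map⁺ fromEntries-injective (boundedVecs-unique r 9))

∈-canonicalPartitions : ∀ {r} p → All (_≤ r) (entries p) → (Canonical p ⇔ p ∈ canonicalPartitions r)
∈-canonicalPartitions {r} p p≤r = mk⇔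
  (∈-filter⁺ canonical? (∈-map⁺ fromEntries (∈-boundedVecs p≤r)))
  (λ p∈ → proj₂ (∈-filter⁻ canonical? {xs = map fromEntries (boundedVecs r 9)} p∈))

boardPartition≤blocked : ∀ k l (b : Board (dim k) (dim l)) → All (_≤ blocked b) (entries (boardPartition k l b))
boardPartition≤blocked k l b =
  ≤b ∷ ≤b ∷ ≤b ∷ ≤b ∷ ≤b ∷ ≤b ∷ ≤b ∷ ≤b ∷ ≤b ∷ []
  where
  ≤b : ∀ {P} → countWhere P b ≤ blocked b
  ≤b {P} = countWhere≤blocked P b

canonical⇔∈canonicalPartitions : ∀ k l r (b : Board (dim k) (dim l)) → InB k l r b →
  (InBbar k l r b ⇔ (boardPartition k l b ∈ canonicalPartitions r))
canonical⇔∈canonicalPartitions k l r b b∈B = mk⇔ (λ (_ , canonical) → to canonical) (λ p∈ → b∈B , from p∈)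
  where
  open Equivalence (∈-canonicalPartitions (boardPartition k l b)
                     (subst (λ n → All (_≤ n) _) b∈B (boardPartition≤blocked k l b)))

canonical-representative : ∀ k l r (b : Board (dim k) (dim l)) → InB k l r b →
  ∃ (λ (b′ : Board (dim k) (dim l)) → InBbar k l r b′ × Equivalent b b′)
canonical-representative k l r b b∈B with canonical-in-orbit (boardPartition k l b)
... | g , canonical = act g b , (gb∈B , gb-canonical) , g , (λ _ _ → refl)
  where
  gb∈B : InB k l r (act g b)
  gb∈B = trans (blocked-act g b) b∈B
  gb-canonical : Canonical (boardPartition k l (act g b))
  gb-canonical = subst Canonical (sym (boardPartition-act k l g b)) canonical

equivalent-canonical⇒same-partition : ∀ k l r (b b′ : Board (dim k) (dim l)) →
  InBbar k l r b → InBbar k l r b′ → Equivalent b b′ → boardPartition k l b ≡ boardPartition k l b′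
equivalent-canonical⇒same-partition k l r b b′ (_ , canonical) (_ , canonical′) (g , b′≈gb) = sym (begin
  boardPartition k l b′          ≡⟨ b′-partition ⟩
  actP g (boardPartition k l b)  ≡⟨ canonical-fixed g _ canonical (subst Canonical b′-partition canonical′) ⟩
  boardPartition k l b           ∎)
  where
  open ≡-Reasoning
  b′-partition : boardPartition k l b′ ≡ actP g (boardPartition k l b)
  b′-partition = trans (boardPartition-cong k l b′≈gb) (boardPartition-act k l g b)

-- The hypotheses on k, l and r are unused: for the group {R0, H, V, R180} the argument
-- works for every grid and every r (a square grid has further symmetries, hence k ≠ l in the paper).
theorem4p7 : (k l r : ℕ) → 1 ≤ k → 1 ≤ l → ¬ (k ≡ l) → 1 ≤ r → r ≤ dim k * dim l →
    (Σ (List Partition) (λ Ps → Unique Ps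
        × ((b : Board (dim k) (dim l)) → InB k l r b →
             (InBbar k l r b ⇔ (boardPartition k l b ∈ Ps)))))
    × ((b : Board (dim k) (dim l)) → InB k l r b →
        ∃ (λ (b' : Board (dim k) (dim l)) → InBbar k l r b' × Equivalent b b'))
    × ((b b' : Board (dim k) (dim l)) → InBbar k l r b → InBbar k l r b' →
        Equivalent b b' → boardPartition k l b ≡ boardPartition k l b')
theorem4p7 k l r _ _ _ _ _ =
    (canonicalPartitions r , canonicalPartitions-unique r , canonical⇔∈canonicalPartitions k l r)
  , canonical-representative k l r
  , equivalent-canonical⇒same-partition k l r
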